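{- Let $H\subseteq\{0,1\}^n$ and let $B$ be a permutation branching program of length $n$ (of any width) with $a$ accept vertices. Then the induced hit program $B_H$ has width at most $|H|\cdot(n+2)\cdot a$.
   Context: A permutation branching program $B$ of length $n$ and width $w$ has layers $V_0,\dots,V_n$, each a copy of $\{1,\dots,w\}$, a start state $v_0\in V_0$, transition functions $B_r:V_{r-1}\times\{0,1\}\to V_r$ ($r=1,\dots,n$) such that each $B_r(\cdot,b)$ is a permutation, and a set $V_{\mathit{acc}}\subseteq V_n$ of accept vertices, $a=|V_{\mathit{acc}}|$. For $v\in V_i$ and $x\in\{0,1\}^{k}$ with $i+k\le n$, $B[v,x]$ denotes the state in $V_{i+k}$ reached from $v$ reading $x$; $B(x)=1$ iff $B[v_0,x]\in V_{\mathit{acc}}$. Induced hit program: for $i=0,\dots,n$ let $K_i=\{v\in V_i:\exists y\in H,\ B[v,y_{1..n-i}]\in V_{\mathit{acc}}\}$ (the hit states), let $K=\max_i|K_i|$, and pad each $K_i$ with fresh padding states to a set $K_i'$ of size exactly $K$. Layer $i$ of $B_H$ is $W_i=K_i'\cup(\{0,\dots,n\}\times[K])$, so all layers have size $(n+2)K$. Fix bijections $\iota_i:K_i'\to[K]$. The transition from $W_i$ to $W_{i+1}$ on bit $b$ sends $v\in K_i$ to $B_{i+1}(v,b)$ if that lies in $K_{i+1}$ and to $(i,\iota_i(v))$ otherwise; sends a padding state $p\in K_i'$ to $(i,\iota_i(p))$; sends $(j,u)$ with $j\ne i$ to $(j,u)$; and on the states $(i,u)$ is defined arbitrarily so that the whole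 map is a bijection $W_i\to W_{i+1}$. The accept set is $K_n\cap V_{\mathit{acc}}$; the start state is $v_0$ if $v_0\in K_0$, and otherwise $(n,1)$ (so $B_H$ rejects everything). -}

module Defs where

open import Data.Nat using (ℕ; zero; suc; _∸_; _<?_; _⊔_)
open import Data.Bool using (Bool)
open import Data.Fin using (Fin; toℕ; fromℕ<)
open import Data.Fin.Subset using (Subset; _∈_; ∣_∣)
open import Data.Fin.Subset.Properties using (_∈?_)
open import Data.Fin.Permutation using (Permutation′; _⟨$⟩ʳ_)
open import Data.List using (List; []; _∷_; take; foldr; map; allFin)
open import Data.List.Relation.Unary.Any using (Any; any?)
open import Data.Vec using (Vec; toList; tabulate)
open import Data.Product using (Σ; _×_; _,_)
open import Relation.Nullary using (does; Dec; yes; no)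

-- A permutation branching program of length n and width w.
-- Layers V_0..V_n are copies of Fin w. Transition B_{r+1} (r : Fin n),
-- from V_r to V_{r+1}, on each bit b is a permutation of Fin w.
record PBP (n w : ℕ) : Set where
  field
    start  : Fin w
    trans  : Fin n → Bool → Permutation′ w
    accept : Subset w

  numAcc : ℕ
  numAcc = ∣ accept ∣

  -- one step from layer i reading bit b (identity beyond layer n; never used there)
  step : ℕ → Bool → Fin w → Fin w
  step i b v with i <? n
  ... | yes p = trans (fromℕ< p) b ⟨$⟩ʳ v
  ... | no _  = v

  -- runFrom i x v  =  B[v, x]  for v ∈ V_i
  runFrom : ℕ → List Bool → Fin w → Fin w
  runFrom i []      v = v
  runFrom i (b ∷ x) v = runFrom (suc i) x (step i b v)

  IsHit : List (Vec Bool n) → Fin (suc n) → Fin w → Set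
  IsHit H i v = Any (λ y → runFrom (toℕ i) (take (n ∸ toℕ i) (toList y)) v ∈ accept) H

  isHit? : (H : List (Vec Bool n)) (i : Fin (suc n)) (v : Fin w) → Dec (IsHit H i v)
  isHit? H i v = any? (λ y → runFrom (toℕ i) (take (n ∸ toℕ i) (toList y)) v ∈? accept) H

  hitSet : List (Vec Bool n) → Fin (suc n) → Subset w
  hitSet H i = tabulate (λ v → does (isHit? H i v))

  maxHit : List (Vec Bool n) → ℕ
  maxHit H = foldr _⊔_ 0 (map (λ i → ∣ hitSet H i ∣) (allFin (suc n)))

  hitWidth : List (Vec Bool n) → ℕ
  hitWidth H = suc (suc n) Data.Nat.* maxHit H

{-# OPTIONS --safe #-}
-- For y ∈ H, the states v ∈ V_i with B[v, y_{1..n-i}] ∈ V_acc form the preimage of V_acc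
-- under a composition of permutations, so there are exactly a of them. K_i is the union
-- of these sets over y ∈ H, hence |K_i| ≤ |H| a for every i, so K ≤ |H| a and the width
-- (n+2) K of B_H is at most |H| (n+2) a.
module Submission where

open import Defs
open import Function using (_∘_)
open import Data.Nat using (ℕ; zero; suc; _*_; _+_; _∸_; _≤_; _<?_; z≤n; s≤s)
open import Data.Nat.Properties
  using (≤-trans; ≤-reflexive; n≤1+n; +-suc; +-monoʳ-≤; +-mono-≤; ⊔-lub; *-monoʳ-≤; *-assoc; *-comm; +-0-commutativeMonoid; module ≤-Reasoning)
open import Data.Bool using (Bool; true; false; _∨_)
open import Data.Vec using (Vec; tabulate; lookup; toList; _∷_)
open import Data.Vec.Properties using (tabulate-cong; tabulate∘lookup)
open import Data.List using (List; length; []; _∷_; take; allFin)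
open import Data.List.Properties using (foldr-preservesᵇ)
open import Data.List.Relation.Unary.All using (universal)
open import Data.List.Relation.Unary.All.Properties using (map⁺)
open import Data.List.Relation.Unary.Unique.Propositional using (Unique)
open import Data.Fin using (Fin; zero; suc; toℕ; fromℕ<)
open import Data.Fin.Subset using (Subset; inside; outside; ∣_∣)
open import Data.Fin.Subset.Properties using (_∈?_)
open import Data.Fin.Permutation using (Permutation′; _⟨$⟩ʳ_)
open import Relation.Nullary using (does; yes; no)
open import Relation.Binary.PropositionalEquality using (_≡_; refl; sym; trans; cong; module ≡-Reasoning)
open import Algebra.Properties.CommutativeMonoid.Sum +-0-commutativeMonoid using (sum; sum-permute)

indicator : Bool → ℕ
indicator true  = 1
indicator false = 0

∣tabulate∣≡sum-indicator : ∀ {w} (g : Fin w → Bool) → ∣ tabulate g ∣ ≡ sum (indicator ∘ g)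
∣tabulate∣≡sum-indicator {zero}  g = refl
∣tabulate∣≡sum-indicator {suc w} g with g zero
... | true  = cong suc (∣tabulate∣≡sum-indicator (g ∘ suc))
... | false = ∣tabulate∣≡sum-indicator (g ∘ suc)

∣tabulate∘permutation∣ : ∀ {w} (g : Fin w → Bool) (π : Permutation′ w) →
                         ∣ tabulate (g ∘ (π ⟨$⟩ʳ_)) ∣ ≡ ∣ tabulate g ∣
∣tabulate∘permutation∣ g π = begin
  ∣ tabulate (g ∘ (π ⟨$⟩ʳ_)) ∣  ≡⟨ ∣tabulate∣≡sum-indicator (g ∘ (π ⟨$⟩ʳ_)) ⟩
  sum (indicator ∘ g ∘ (π ⟨$⟩ʳ_)) ≡⟨ sym (sum-permute (indicator ∘ g) π) ⟩
  sum (indicator ∘ g)             ≡⟨ sym (∣tabulate∣≡sum-indicator g) ⟩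
  ∣ tabulate g ∣                  ∎
  where open ≡-Reasoning

∣tabulate-∨∣≤ : ∀ {w} (g h : Fin w → Bool) →
                ∣ tabulate (λ v → g v ∨ h v) ∣ ≤ ∣ tabulate g ∣ + ∣ tabulate h ∣
∣tabulate-∨∣≤ {zero}  g h = z≤n
∣tabulate-∨∣≤ {suc w} g h with g zero | h zero | ∣tabulate-∨∣≤ (g ∘ suc) (h ∘ suc)
... | true  | true  | le = s≤s (≤-trans le (+-monoʳ-≤ ∣ tabulate (g ∘ suc) ∣ (n≤1+n _)))
... | true  | false | le = s≤s le
... | false | true  | le = ≤-trans (s≤s le) (≤-reflexive (sym (+-suc _ _)))
... | false | false | le = le

∣tabulate-false∣≡0 : ∀ w → ∣ tabulate {n = w} (λ _ → false) ∣ ≡ 0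
∣tabulate-false∣≡0 zero    = refl
∣tabulate-false∣≡0 (suc w) = ∣tabulate-false∣≡0 w

does-∈?≡lookup : ∀ {w} (v : Fin w) (p : Subset w) → does (v ∈? p) ≡ lookup p v
does-∈?≡lookup zero    (inside  ∷ p) = refl
does-∈?≡lookup zero    (outside ∷ p) = refl
does-∈?≡lookup (suc v) (_ ∷ p)       = does-∈?≡lookup v p

tabulate-∈? : ∀ {w} (p : Subset w) → tabulate (λ v → does (v ∈? p)) ≡ p
tabulate-∈? p = trans (tabulate-cong (λ v → does-∈?≡lookup v p)) (tabulate∘lookup p)

module _ {n w : ℕ} (B : PBP n w) where
  open PBP B renaming (trans to transition)

  ∣tabulate∘step∣ : ∀ i b (g : Fin w → Bool) → ∣ tabulate (g ∘ step i b) ∣ ≡ ∣ tabulate g ∣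
  ∣tabulate∘step∣ i b g with i <? n
  ... | yes i<n = ∣tabulate∘permutation∣ g (transition (fromℕ< i<n) b)
  ... | no  _   = refl

  ∣tabulate∘runFrom∣ : ∀ i x (g : Fin w → Bool) → ∣ tabulate (g ∘ runFrom i x) ∣ ≡ ∣ tabulate g ∣
  ∣tabulate∘runFrom∣ i []      g = refl
  ∣tabulate∘runFrom∣ i (b ∷ x) g =
    trans (∣tabulate∘step∣ i b (g ∘ runFrom (suc i) x)) (∣tabulate∘runFrom∣ (suc i) x g)

  ∣runFrom⁻¹-accept∣≡numAcc : ∀ i x → ∣ tabulate (λ v → does (runFrom i x v ∈? accept)) ∣ ≡ numAcc
  ∣runFrom⁻¹-accept∣≡numAcc i x =
    trans (∣tabulate∘runFrom∣ i x (λ u → does (u ∈? accept))) (cong ∣_∣ (tabulate-∈? accept))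

  ∣hitSet∣≤ : ∀ H i → ∣ hitSet H i ∣ ≤ length H * numAcc
  ∣hitSet∣≤ []      i = ≤-reflexive (∣tabulate-false∣≡0 w)
  ∣hitSet∣≤ (y ∷ H) i = begin
    ∣ hitSet (y ∷ H) i ∣                  ≤⟨ ∣tabulate-∨∣≤ acceptsAlong-y (λ v → does (isHit? H i v)) ⟩
    ∣ tabulate acceptsAlong-y ∣ + ∣ hitSet H i ∣
      ≤⟨ +-mono-≤ (≤-reflexive (∣runFrom⁻¹-accept∣≡numAcc (toℕ i) suffix)) (∣hitSet∣≤ H i) ⟩
    numAcc + length H * numAcc            ∎
    where
      open ≤-Reasoning
      suffix : List Bool
      suffix = take (n ∸ toℕ i) (toList y)
      acceptsAlong-y : Fin w → Bool
      acceptsAlong-y v = does (runFrom (toℕ i) suffix v ∈? accept)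

  maxHit≤ : ∀ H → maxHit H ≤ length H * numAcc
  maxHit≤ H = foldr-preservesᵇ {P = _≤ length H * numAcc} ⊔-lub z≤n
    (map⁺ (universal (∣hitSet∣≤ H) (allFin (suc n))))

lemma3p2 : (n w : ℕ) (B : PBP n w) (H : List (Vec Bool n)) → Unique H →
    PBP.hitWidth B H ≤ length H * suc (suc n) * PBP.numAcc B
lemma3p2 n w B H _ = begin
  suc (suc n) * PBP.maxHit B H                 ≤⟨ *-monoʳ-≤ (suc (suc n)) (maxHit≤ B H) ⟩
  suc (suc n) * (length H * PBP.numAcc B)      ≡⟨ sym (*-assoc (suc (suc n)) (length H) _) ⟩
  suc (suc n) * length H * PBP.numAcc B        ≡⟨ cong (_* PBP.numAcc B) (*-comm (suc (suc n)) (length H)) ⟩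
  length H * suc (suc n) * PBP.numAcc B        ∎
  where open ≤-Reasoning
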